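{- In $\mathsf{BIM}+\forall k[\mathbf{IRT}(k)]$ one may prove: for all $k$ and all $\alpha,\beta$, if $E_\alpha$ and $E_\beta$ are $k$-almost-full, then $E_\alpha\cap E_\beta$ is $k$-almost-full.
   Context: $\mathsf{BIM}$ is the two-sorted intuitionistic theory of natural numbers and functions $\mathbb N\to\mathbb N$ with extensionality, primitive recursive constants, closure of functions under composition, primitive recursion and unbounded search, and full induction. Finite sequences are coded by naturals. $D_\alpha=\{n\mid\alpha(n)\ne0\}$, $E_\alpha=\{n\mid\exists p[\alpha(p)=n+1]\}$. $[\omega]^\omega$: strictly increasing $\zeta:\mathbb N\to\mathbb N$; $[\omega]^k$: codes of strictly increasing sequences of length $k$; $\zeta\circ s$ is the code of $\langle\zeta(s(0)),\dots,\zeta(s(k-1))\rangle$. $X$ is $k$-almost-full if $\forall\zeta\in[\omega]^\omega\exists s\in[\omega]^k[\zeta\circ s\in X]$. For $k\ge1$, $\mathbf{IRT}(k)$ is: for all $\alpha,\beta$, if $D_\alpha$ and $D_\beta$ are $k$-almost-full then $D_\alpha\cap D_\beta$ is $k$-almost-full. -}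

module Defs where

open import Data.Nat using (ℕ; zero; suc; _+_; _<_; _≤_)
open import Data.List using (List; []; _∷_; length; map)
open import Data.List.Relation.Unary.Linked using (Linked)
open import Data.Product using (Σ; _×_; ∃)
open import Relation.Binary.PropositionalEquality using (_≡_)
open import Relation.Nullary using (¬_)

Subset : Set₁
Subset = ℕ → Set

_∩_ : Subset → Subset → Subset
(X ∩ Y) n = X n × Y n

-- Coding of finite sequences by naturals (Cantor pairing; injective).
tri : ℕ → ℕ
tri zero    = zero
tri (suc n) = suc n + tri n

pair : ℕ → ℕ → ℕ
pair x y = tri (x + y) + y

code : List ℕ → ℕ
code []      = zero
code (x ∷ s) = suc (pair x (code s))

D : (ℕ → ℕ) → Subset
D α n = ¬ (α n ≡ 0)

E : (ℕ → ℕ) → Subset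
E α n = ∃ λ p → α p ≡ suc n

StrictlyIncreasing : (ℕ → ℕ) → Set
StrictlyIncreasing ζ = ∀ m n → m < n → ζ m < ζ n

InOmegaK : ℕ → List ℕ → Set
InOmegaK k s = (length s ≡ k) × Linked _<_ s

AlmostFull : ℕ → Subset → Set
AlmostFull k X = ∀ ζ → StrictlyIncreasing ζ →
  Σ (List ℕ) λ s → InOmegaK k s × X (code (map ζ s))

IRT : ℕ → Set
IRT k = ∀ α β → AlmostFull k (D α) → AlmostFull k (D β) → AlmostFull k (D α ∩ D β)

-- Idea: raise the exponent by one to absorb the existential quantifier of
-- E_α.  For each α we define a function δ α whose decidable set D_(δ α)
-- contains the code of ⟨s₀,…,s_(k-1),y⟩ exactly when α takes the value
-- code ⟨s₀,…,s_(k-1)⟩ + 1 at some argument p ≤ y.  Then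
--   * if E_α is k-almost-full, D_(δ α) is (k+1)-almost-full: extend a
--     witness s by one element m so large that ζ(m) bounds the argument p;
--   * if D_(δ α) ∩ D_(δ β) is (k+1)-almost-full, E_α ∩ E_β is k-almost-full:
--     drop the last element of a witness.
module Submission where

open import Defs
open import Data.Nat using (ℕ; zero; suc; _+_; _≤_; _<_; z≤n; s≤s; _≟_)
open import Data.Nat.Properties
  using (+-suc; +-comm; +-identityʳ; suc-injective; 1+n≢0;
         ≤-refl; ≤-trans; m≤m+n; m≤n+m; n≤1+n)
open import Data.Nat.ListAction using (sum)
open import Data.Fin using (Fin; toℕ; fromℕ<)
open import Data.Fin.Properties using (any?; toℕ-fromℕ<)
open import Data.List using (List; []; _∷_; length; map; _++_; _∷ʳ_; [_]; initLast; InitLast; _∷ʳ′_)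
open import Data.List.Properties using (map-++; length-++)
open import Data.List.Relation.Unary.Linked using (Linked; []; [-]; _∷_)
open import Data.List.Relation.Unary.All as All using (All; []; _∷_)
open import Data.Maybe using (Maybe; just; nothing)
open import Data.Product using (Σ; _×_; _,_; ∃)
import Data.Product as Product
open import Data.Empty using (⊥-elim)
open import Relation.Nullary using (Dec; yes; no; ¬_)
open import Relation.Binary.PropositionalEquality
  using (_≡_; refl; sym; trans; cong; subst)

next : ℕ × ℕ → ℕ × ℕ
next (zero  , y) = (suc y , 0)
next (suc x , y) = (x , suc y)

unpair : ℕ → ℕ × ℕ
unpair zero    = (0 , 0)
unpair (suc n) = next (unpair n)

pair-along : ∀ x y → suc (pair (suc x) y) ≡ pair x (suc y)
pair-along x y rewrite +-suc x y | +-suc (tri (suc (x + y))) y = refl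

pair-wrap : ∀ y → suc (pair 0 y) ≡ pair (suc y) 0
pair-wrap y rewrite +-identityʳ y | +-identityʳ (suc y + tri y) | +-comm (tri y) y = refl

unpair-pair : ∀ n x y → pair x y ≡ n → unpair n ≡ (x , y)
unpair-pair zero    zero    zero    _ = refl
unpair-pair zero    zero    (suc y) e = ⊥-elim (1+n≢0 (trans (sym (+-suc (tri (suc y)) y)) e))
unpair-pair zero    (suc x) y       ()
unpair-pair (suc n) zero    zero    ()
unpair-pair (suc n) x       (suc y) e
  rewrite unpair-pair n (suc x) y (suc-injective (trans (pair-along x y) e)) = refl
unpair-pair (suc n) (suc x) zero    e
  rewrite unpair-pair n 0 x (suc-injective (trans (pair-wrap x) e)) = refl

-- Decoding with an explicit fuel bound; the code itself is enough fuel,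
-- since the code of a tail is smaller than the code of the whole list.
decodeWithin : ℕ → ℕ → List ℕ
decodeWithin zero    _       = []
decodeWithin (suc f) zero    = []
decodeWithin (suc f) (suc n) = Product.proj₁ (unpair n) ∷ decodeWithin f (Product.proj₂ (unpair n))

decode : ℕ → List ℕ
decode n = decodeWithin n n

decodeWithin-code : ∀ u f → code u ≤ f → decodeWithin f (code u) ≡ u
decodeWithin-code []      zero    _ = refl
decodeWithin-code []      (suc f) _ = refl
decodeWithin-code (x ∷ s) (suc f) (s≤s le)
  rewrite unpair-pair (pair x (code s)) x (code s) refl =
  cong (x ∷_) (decodeWithin-code s f (≤-trans (m≤n+m (code s) (tri (x + code s))) le))

decode-code : ∀ u → decode (code u) ≡ u
decode-code u = decodeWithin-code u (code u) ≤-refl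

splitLast : List ℕ → Maybe (List ℕ × ℕ)
splitLast []       = nothing
splitLast (x ∷ xs) with splitLast xs
... | nothing      = just ([] , x)
... | just (t , y) = just (x ∷ t , y)

splitLast-∷ʳ : ∀ t y → splitLast (t ∷ʳ y) ≡ just (t , y)
splitLast-∷ʳ []      y = refl
splitLast-∷ʳ (x ∷ t) y rewrite splitLast-∷ʳ t y = refl

indicator : ∀ {P : Set} → Dec P → ℕ
indicator (yes _) = 1
indicator (no _)  = 0

indicator-sound : ∀ {P : Set} (d : Dec P) → ¬ (indicator d ≡ 0) → P
indicator-sound (yes p) _  = p
indicator-sound (no _)  nz = ⊥-elim (nz refl)

indicator-complete : ∀ {P : Set} (d : Dec P) → P → ¬ (indicator d ≡ 0)
indicator-complete (yes _) _ ()
indicator-complete (no ¬p) p _ = ¬p p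

HitsBelow : (ℕ → ℕ) → ℕ → ℕ → Set
HitsBelow α c y = ∃ λ (i : Fin (suc y)) → α (toℕ i) ≡ c

hitsBelow? : ∀ α c y → Dec (HitsBelow α c y)
hitsBelow? α c y = any? (λ i → α (toℕ i) ≟ c)

searchLast : (ℕ → ℕ) → Maybe (List ℕ × ℕ) → ℕ
searchLast α nothing        = 0
searchLast α (just (t , y)) = indicator (hitsBelow? α (suc (code t)) y)

δ : (ℕ → ℕ) → ℕ → ℕ
δ α n = searchLast α (splitLast (decode n))

δ-∷ʳ : ∀ α t y → δ α (code (t ∷ʳ y)) ≡ indicator (hitsBelow? α (suc (code t)) y)
δ-∷ʳ α t y rewrite decode-code (t ∷ʳ y) | splitLast-∷ʳ t y = refl

δ-sound : ∀ α t y → D (δ α) (code (t ∷ʳ y)) → E α (code t)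
δ-sound α t y d with indicator-sound (hitsBelow? α _ y) (λ z → d (trans (δ-∷ʳ α t y) z))
... | i , αi = toℕ i , αi

δ-complete : ∀ α t y p → p ≤ y → α p ≡ suc (code t) → D (δ α) (code (t ∷ʳ y))
δ-complete α t y p p≤y αp z =
  indicator-complete (hitsBelow? α _ y) hit (trans (sym (δ-∷ʳ α t y)) z)
  where
  hit : HitsBelow α (suc (code t)) y
  hit = fromℕ< (s≤s p≤y) , trans (cong α (toℕ-fromℕ< (s≤s p≤y))) αp

length-∷ʳ : ∀ (s : List ℕ) m k → length s ≡ k → length (s ∷ʳ m) ≡ suc k
length-∷ʳ s m k e rewrite length-++ s {[ m ]} | e = +-comm k 1

length-init : ∀ (t : List ℕ) y k → length (t ∷ʳ y) ≡ suc k → length t ≡ k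
length-init t y k e rewrite length-++ t {[ y ]} = suc-injective (trans (+-comm 1 (length t)) e)

linked-∷ʳ : ∀ {s m} → Linked _<_ s → All (_< m) s → Linked _<_ (s ∷ʳ m)
linked-∷ʳ []      []           = [-]
linked-∷ʳ [-]     (x<m ∷ [])   = x<m ∷ [-]
linked-∷ʳ (r ∷ l) (_ ∷ below)  = r ∷ linked-∷ʳ l below

linked-++ˡ : ∀ {A : Set} {R : A → A → Set} {t u : List A} → Linked R (t ++ u) → Linked R t
linked-++ˡ {t = []}         _       = []
linked-++ˡ {t = x ∷ []}     _       = [-]
linked-++ˡ {t = x ∷ y ∷ t} (r ∷ l) = r ∷ linked-++ˡ {t = y ∷ t} l

all-≤-sum : ∀ s → All (_≤ sum s) s
all-≤-sum []      = []
all-≤-sum (x ∷ s) = m≤m+n x (sum s) ∷ All.map (λ le → ≤-trans le (m≤n+m (sum s) x)) (all-≤-sum s)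

beyond : List ℕ → ℕ → ℕ
beyond s p = suc (sum s + p)

beyond-above : ∀ s p → All (_< beyond s p) s
beyond-above s p = All.map (λ le → s≤s (≤-trans le (m≤m+n (sum s) p))) (all-≤-sum s)

beyond-≥ : ∀ s p → p ≤ beyond s p
beyond-≥ s p = ≤-trans (m≤n+m p (sum s)) (n≤1+n _)

increasing-≥ : ∀ η → StrictlyIncreasing η → ∀ n → n ≤ η n
increasing-≥ η inc zero    = z≤n
increasing-≥ η inc (suc n) = ≤-trans (s≤s (increasing-≥ η inc n)) (inc n (suc n) ≤-refl)

-- E_α k-almost-full ⇒ D_(δ α) (k+1)-almost-full: append to a witness s an
-- index m so large that ζ(m) bounds the argument where α hits the code.
almostFull-δ : ∀ k α → AlmostFull k (E α) → AlmostFull (suc k) (D (δ α))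
almostFull-δ k α af ζ inc with af ζ inc
... | s , (len , lnk) , (p , αp) =
  s ∷ʳ m , (length-∷ʳ s m k len , linked-∷ʳ lnk (beyond-above s p)) , inD
  where
  m : ℕ
  m = beyond s p

  inD : D (δ α) (code (map ζ (s ∷ʳ m)))
  inD = subst (λ u → D (δ α) (code u)) (sym (map-++ ζ s [ m ]))
          (δ-complete α (map ζ s) (ζ m) p (≤-trans (beyond-≥ s p) (increasing-≥ ζ inc m)) αp)

almostFull-dropLast : ∀ {k} {X Y : Subset} →
  (∀ t y → X (code (t ∷ʳ y)) → Y (code t)) →
  AlmostFull (suc k) X → AlmostFull k Y
almostFull-dropLast {k} {X} {Y} drop af ζ inc with af ζ inc
... | s , (len , lnk) , x = shorten s (initLast s) len lnk x
  where
  shorten : ∀ s → InitLast s → length s ≡ suc k → Linked _<_ s → X (code (map ζ s)) →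
            Σ (List ℕ) λ t → InOmegaK k t × Y (code (map ζ t))
  shorten .[]       []         ()  _   _
  shorten .(t ∷ʳ y) (t ∷ʳ′ y) len lnk x =
    t , (length-init t y k len , linked-++ˡ lnk) ,
    drop (map ζ t) (ζ y) (subst (λ u → X (code u)) (map-++ ζ t [ y ]) x)

corollary10p3 : (∀ k → 1 ≤ k → IRT k) →
    ∀ k (α β : ℕ → ℕ) → AlmostFull k (E α) → AlmostFull k (E β) → AlmostFull k (E α ∩ E β)
corollary10p3 irt k α β afα afβ =
  almostFull-dropLast {X = D (δ α) ∩ D (δ β)} {Y = E α ∩ E β} (λ t y → Product.map (δ-sound α t y) (δ-sound β t y))
    (irt (suc k) (s≤s z≤n) (δ α) (δ β) (almostFull-δ k α afα) (almostFull-δ k β afβ))
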